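{- Let $j\ge2$ be an integer and let $T$ be a tree with exactly $j$ leaves. Then $\mathrm{capt}_{\zeta,j}(T)=1$.
   Context: A leaf is a vertex of degree 1. The localization game on a connected graph $G$ with $k$ cops: the robber, invisible to the cops, first chooses a starting vertex. In each round the cops choose a multiset of vertices $u_1,\dots,u_k$ (no adjacency restriction) and learn the distances $d(u_i,R)$ to the robber's current vertex $R$; the cops capture the robber if, from all information so far, they can determine the robber's vertex uniquely. If not captured, the robber moves to a neighbor or stays. The robber is omniscient. The localization number $\zeta(G)$ is the least number of cops guaranteeing capture; every tree has $\zeta(T)\le2$. For $k\ge\zeta(G)$, $\mathrm{capt}_{\zeta,k}(G)$ is the minimum number of rounds in which $k$ cops can guarantee capture under optimal play. -}

module Defs where

open import Data.Nat using (ℕ; zero; suc; _<_; _≤_)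
open import Data.Bool using (Bool; true; false)
open import Data.Fin using (Fin; zero; suc; inject₁; fromℕ)
open import Data.List using (length; filterᵇ)
open import Data.List.Base using () renaming (allFin to allFinL)
open import Data.Vec using (Vec; lookup)
open import Data.Product using (Σ; ∃; _×_)
open import Data.Sum using (_⊎_)
open import Data.Empty using (⊥)
open import Data.Unit using (⊤)
open import Relation.Nullary using (¬_)
open import Relation.Binary.PropositionalEquality using (_≡_)

record Graph (n : ℕ) : Set where
  field
    Adj     : Fin n → Fin n → Bool
    sym     : ∀ u v → Adj u v ≡ Adj v u
    loopless : ∀ v → Adj v v ≡ false
open Graph public

module _ {n : ℕ} (G : Graph n) where

  data Walk : Fin n → Fin n → ℕ → Set where
    here : ∀ {v} → Walk v v 0
    step : ∀ {u w v m} → Adj G u w ≡ true → Walk w v m → Walk u v (suc m)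

  Connected : Set
  Connected = ∀ u v → ∃ λ m → Walk u v m

  record Cycle : Set where
    field
      len  : ℕ
      c    : Fin (suc (suc (suc len))) → Fin n
      inj  : ∀ i j → c i ≡ c j → i ≡ j
      adj  : ∀ (i : Fin (suc (suc len))) → Adj G (c (inject₁ i)) (c (suc i)) ≡ true
      close : Adj G (c (fromℕ (suc (suc len)))) (c zero) ≡ true

  Acyclic : Set
  Acyclic = ¬ Cycle

  IsTree : Set
  IsTree = Connected × Acyclic

  degree : Fin n → ℕ
  degree v = length (filterᵇ (Adj G v) (allFinL n))

  IsLeaf : Fin n → Set
  IsLeaf v = degree v ≡ 1

  numLeaves : ℕ
  numLeaves = length (filterᵇ (λ v → isOne (degree v)) (allFinL n))
    where
    isOne : ℕ → Bool
    isOne (suc zero) = true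
    isOne _ = false

  Dist : Fin n → Fin n → ℕ → Set
  Dist u v m = Walk u v m × (∀ m' → Walk u v m' → m ≤ m')

  SameResp : ∀ {k} → Vec (Fin n) k → Fin n → Fin n → Set
  SameResp {k} u v r = ∀ (i : Fin k) → ∃ λ m → Dist (lookup u i) v m × Dist (lookup u i) r m

  -- Win k t S : k cops, knowing only that the robber's current vertex lies in
  -- S (the set of positions consistent with all information so far), can
  -- guarantee capture within t further rounds.
  Win : ℕ → ℕ → (Fin n → Set) → Set
  Win k zero S = ⊥
  Win k (suc t) S =
    Σ (Vec (Fin n) k) λ u → ∀ r → S r →
      (∀ v → S v → SameResp u v r → v ≡ r)
      ⊎ Win k t (λ w → ∃ λ v → (S v × SameResp u v r) × (w ≡ v ⊎ Adj G v w ≡ true))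

  AllVertices : Fin n → Set
  AllVertices _ = ⊤

  -- capt_{ζ,k}(G) = t : the least number of rounds in which k cops can
  -- guarantee capture (robber starts anywhere)
  CaptTime : ℕ → ℕ → Set
  CaptTime k t = Win k t AllVertices × (∀ t' → t' < t → ¬ Win k t' AllVertices)

{-# OPTIONS --safe #-}
module Submission where

-- Put one cop on every leaf. If v ≠ r, follow the path from v to r and
-- keep walking past r, never turning back, until a leaf ℓ is reached. The
-- non-backtracking walk from ℓ to v runs through r, and in a tree a
-- non-backtracking walk is the unique geodesic, so d(ℓ,r) < d(ℓ,v): the
-- leaf cops distinguish every pair of vertices in the first round.

open import Defs
open import Data.Nat using (ℕ; zero; suc; _+_; _≤_; _<_; z≤n; s≤s)
open import Data.Nat.Properties
  using (≤-trans; n≤1+n; +-suc; m≤m+n; <⇒≱; n>0⇒n≢0)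
open Data.Nat.Properties.≤-Reasoning
open import Data.Bool using (Bool; true) renaming (T to True)
open import Data.Bool.Properties using (T-≡)
open import Relation.Nullary.Decidable.Core using (T?)
open import Data.Fin using (Fin; zero; suc; inject₁; fromℕ; _≟_)
open import Data.Fin.Properties using (injective⇒≤)
open import Data.List using (List; []; _∷_; length; filterᵇ)
open import Data.List.Base using () renaming (allFin to allFinL)
open import Data.List.Properties using (filter-some)
open import Data.List.Membership.Propositional using (lose) renaming (_∈_ to _∈ₗ_)
open import Data.List.Membership.Propositional.Properties using (∈-filter⁺; ∈-filter⁻; ∈-allFin)
open import Data.List.Relation.Unary.Any using (here; there)
open import Data.List.Relation.Unary.All using (_∷_)
open import Data.List.Relation.Unary.AllPairs using (_∷_)
open import Data.List.Relation.Unary.Unique.Propositional using (Unique)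
open import Data.List.Relation.Unary.Unique.Propositional.Properties using (allFin⁺; filter⁺)
open import Data.Vec using (Vec; fromList)
open import Data.Vec.Membership.Propositional using (_∈_)
open import Data.Vec.Membership.Propositional.Properties using (∈-fromList⁺)
open import Data.Vec.Relation.Unary.Any using (index)
open import Data.Vec.Relation.Unary.Any.Properties using (lookup-index)
open import Data.Product using (Σ; ∃; _×_; _,_; proj₁; proj₂)
open import Data.Sum using (_⊎_; inj₁; inj₂; [_,_])
open import Data.Empty using (⊥; ⊥-elim)
open import Data.Unit using (⊤; tt)
open import Function using (_∘_; Equivalence)
open import Relation.Nullary using (¬_; yes; no)
open import Relation.Binary.PropositionalEquality
  using (_≡_; _≢_; refl; trans; cong; subst; subst₂)
  renaming (sym to ≡-sym)

unique⇒∃≢ : ∀ {n} (xs : List (Fin n)) → Unique xs → 2 ≤ length xs →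
            ∀ p → ∃ λ y → y ∈ₗ xs × y ≢ p
unique⇒∃≢ (_ ∷ []) _ (s≤s ())
unique⇒∃≢ (a ∷ b ∷ xs) ((a≢b ∷ _) ∷ _) _ p with a ≟ p
... | yes refl = b , there (here refl) , a≢b ∘ ≡-sym
... | no a≢p   = a , here refl , a≢p

-- Addition recursing on the first argument into the second: the length
-- that reverse-appending two walks produces definitionally.
_⊕_ : ℕ → ℕ → ℕ
zero  ⊕ q = q
suc p ⊕ q = p ⊕ suc q

⊕≡+ : ∀ p q → p ⊕ q ≡ p + q
⊕≡+ zero    q = refl
⊕≡+ (suc p) q = trans (⊕≡+ p (suc q)) (+-suc p q)

module _ {n : ℕ} (G : Graph n) where

  Adj-sym : ∀ {u v} → Adj G u v ≡ true → Adj G v u ≡ true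
  Adj-sym {u} {v} = trans (Graph.sym G v u)

  Adj-irrefl : ∀ {v} → Adj G v v ≢ true
  Adj-irrefl {v} e with trans (≡-sym e) (loopless G v)
  ... | ()

  _∈ᵂ_ : ∀ {u v m} → Fin n → Walk G u v m → Set
  t ∈ᵂ here {v}       = t ≡ v
  t ∈ᵂ step {u} _ w   = t ≡ u ⊎ t ∈ᵂ w

  end∈ᵂ : ∀ {u v m} (w : Walk G u v m) → v ∈ᵂ w
  end∈ᵂ here       = refl
  end∈ᵂ (step _ w) = inj₂ (end∈ᵂ w)

  IsPath : ∀ {u v m} → Walk G u v m → Set
  IsPath here             = ⊤
  IsPath (step {u} _ w)   = ¬ (u ∈ᵂ w) × IsPath w

  NonBacktracking : ∀ {u v m} → Walk G u v m → Set
  NonBacktracking here                              = ⊤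
  NonBacktracking (step _ here)                     = ⊤
  NonBacktracking (step {u} _ (step {w = x} e w))   = u ≢ x × NonBacktracking (step e w)

  NonBacktracking-tail : ∀ {u x v m} (e : Adj G u x ≡ true) (w : Walk G x v m) →
                         NonBacktracking (step e w) → NonBacktracking w
  NonBacktracking-tail _ here                  _        = tt
  NonBacktracking-tail _ (step _ here)         _        = tt
  NonBacktracking-tail _ (step _ (step _ _))   (_ , nb) = nb

  vertexAt : ∀ {u v m} → Walk G u v m → Fin (suc m) → Fin n
  vertexAt (here {v})      zero    = v
  vertexAt (step {u} _ _)  zero    = u
  vertexAt (step _ w)      (suc i) = vertexAt w i

  vertexAt-first : ∀ {u v m} (w : Walk G u v m) → vertexAt w zero ≡ u
  vertexAt-first here       = refl
  vertexAt-first (step _ _) = refl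

  vertexAt-last : ∀ {u v m} (w : Walk G u v m) → vertexAt w (fromℕ m) ≡ v
  vertexAt-last here       = refl
  vertexAt-last (step _ w) = vertexAt-last w

  vertexAt-adjacent : ∀ {u v m} (w : Walk G u v m) (i : Fin m) →
                      Adj G (vertexAt w (inject₁ i)) (vertexAt w (suc i)) ≡ true
  vertexAt-adjacent (step {u} e w) zero    = subst (λ y → Adj G u y ≡ true) (≡-sym (vertexAt-first w)) e
  vertexAt-adjacent (step _ w)     (suc i) = vertexAt-adjacent w i

  vertexAt-∈ᵂ : ∀ {u v m} (w : Walk G u v m) i → vertexAt w i ∈ᵂ w
  vertexAt-∈ᵂ here       zero    = refl
  vertexAt-∈ᵂ (step _ w) zero    = inj₁ refl
  vertexAt-∈ᵂ (step _ w) (suc i) = inj₂ (vertexAt-∈ᵂ w i)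

  vertexAt-injective : ∀ {u v m} (w : Walk G u v m) → IsPath w →
                       ∀ i j → vertexAt w i ≡ vertexAt w j → i ≡ j
  vertexAt-injective here       _         zero    zero    _  = refl
  vertexAt-injective (step _ w) _         zero    zero    _  = refl
  vertexAt-injective (step _ w) (u∉w , _) zero    (suc j) eq = ⊥-elim (u∉w (subst (_∈ᵂ w) (≡-sym eq) (vertexAt-∈ᵂ w j)))
  vertexAt-injective (step _ w) (u∉w , _) (suc i) zero    eq = ⊥-elim (u∉w (subst (_∈ᵂ w) eq (vertexAt-∈ᵂ w i)))
  vertexAt-injective (step _ w) (_ , pw)  (suc i) (suc j) eq = cong suc (vertexAt-injective w pw i j eq)

  IsPath⇒length<n : ∀ {u v m} (w : Walk G u v m) → IsPath w → m < n
  IsPath⇒length<n w pw = injective⇒≤ (λ {i} {j} → vertexAt-injective w pw i j)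

  path+edge⇒cycle : ∀ {x u m} (P : Walk G x u (suc (suc m))) → IsPath P → Adj G u x ≡ true → Cycle G
  path+edge⇒cycle {m = m} P pP e = record
    { len   = m
    ; c     = vertexAt P
    ; inj   = vertexAt-injective P pP
    ; adj   = vertexAt-adjacent P
    ; close = subst₂ (λ a b → Adj G a b ≡ true) (≡-sym (vertexAt-last P)) (≡-sym (vertexAt-first P)) e
    }

  prefixTo : ∀ {a b m t} (w : Walk G a b m) → t ∈ᵂ w →
             ∃ λ k → Σ (Walk G a t k) λ q → (∀ {s} → s ∈ᵂ q → s ∈ᵂ w) × (IsPath w → IsPath q)
  prefixTo here       refl        = 0 , here , (λ s∈ → s∈) , (λ _ → tt)
  prefixTo (step _ _) (inj₁ refl) = 0 , here , inj₁ , (λ _ → tt)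
  prefixTo (step e w) (inj₂ t∈w) with prefixTo w t∈w
  ... | k , q , q⊆w , path = suc k , step e q , [ inj₁ , inj₂ ∘ q⊆w ] , λ (u∉w , pw) → u∉w ∘ q⊆w , path pw

  reverseAppend : ∀ {a b c p q} → Walk G a b p → Walk G a c q → Walk G b c (p ⊕ q)
  reverseAppend here       w' = w'
  reverseAppend (step e w) w' = reverseAppend w (step (Adj-sym e) w')

  Diverge : ∀ {a b c p q} → Walk G a b p → Walk G a c q → Set
  Diverge here                 _                    = ⊤
  Diverge (step _ _)           here                 = ⊤
  Diverge (step {w = x} _ _)   (step {w = y} _ _)   = x ≢ y

  reverseAppend-nonBacktracking :
    ∀ {a b c p q} (w : Walk G a b p) (w' : Walk G a c q) →
    NonBacktracking w → NonBacktracking w' → Diverge w w' → NonBacktracking (reverseAppend w w')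
  reverseAppend-nonBacktracking here       w' _  nb' _ = nb'
  reverseAppend-nonBacktracking (step e w) w' nb nb' div =
    reverseAppend-nonBacktracking w (step (Adj-sym e) w') (NonBacktracking-tail e w nb) (cons w' nb' div) (diverge w nb)
    where
    cons : ∀ {c q} (w' : Walk G _ c q) → NonBacktracking w' → Diverge (step e w) w' →
           NonBacktracking (step (Adj-sym e) w')
    cons here        _   _   = tt
    cons (step _ _)  nb' div = div , nb'
    diverge : ∀ {b p} (w : Walk G _ b p) → NonBacktracking (step e w) → Diverge w (step (Adj-sym e) w')
    diverge here       _        = tt
    diverge (step _ _) (a≢y , _) = a≢y ∘ ≡-sym

  shortcut : ∀ {a b m} (w : Walk G a b m) → ∃ λ m' → m' ≤ m × Σ (Walk G a b m') NonBacktracking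
  shortcut here = 0 , z≤n , here , tt
  shortcut (step e w) with shortcut w
  ... | _ , _ , here , _ = 1 , s≤s z≤n , step e here , tt
  shortcut (step {a} e w) | suc k , k<m , step {w = y} e' w' , nb with a ≟ y
  ... | yes refl = k , ≤-trans (n≤1+n k) (≤-trans k<m (n≤1+n _)) , w' , NonBacktracking-tail e' w' nb
  ... | no a≢y   = suc (suc k) , s≤s k<m , step e (step e' w') , a≢y , nb

  neighbours : Fin n → List (Fin n)
  neighbours x = filterᵇ (Adj G x) (allFinL n)

  Adj⇒degree≢0 : ∀ {x p} → Adj G x p ≡ true → degree G x ≢ 0
  Adj⇒degree≢0 {x} {p} e =
    n>0⇒n≢0 (filter-some (T? ∘ Adj G x) (lose (∈-allFin p) (Equivalence.from T-≡ e)))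

  degree≥2⇒other-neighbour : ∀ {x} → 2 ≤ degree G x → ∀ p → ∃ λ y → Adj G x y ≡ true × y ≢ p
  degree≥2⇒other-neighbour {x} deg≥2 p
    with unique⇒∃≢ (neighbours x) (filter⁺ (T? ∘ Adj G x) (allFin⁺ n)) deg≥2 p
  ... | y , y∈ , y≢p = y , Equivalence.to T-≡ (proj₂ (∈-filter⁻ (T? ∘ Adj G x) {xs = allFinL n} y∈)) , y≢p

module _ {n : ℕ} {G : Graph n} (acyclic : Acyclic G) where

  -- a return to u inside w would close a cycle through u and the next two vertices
  nonBacktracking⇒start∉ : ∀ {u x v m} (e : Adj G u x ≡ true) (w : Walk G x v m) →
                            NonBacktracking G (step e w) → IsPath G w → ¬ (_∈ᵂ_ G u w)
  nonBacktracking⇒start∉ e here                   _         _                refl               = Adj-irrefl G e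
  nonBacktracking⇒start∉ e (step _ _)             _         _                (inj₁ refl)        = Adj-irrefl G e
  nonBacktracking⇒start∉ e (step _ here)          (u≢y , _) _                (inj₂ refl)        = u≢y refl
  nonBacktracking⇒start∉ e (step _ (step _ _))    (u≢y , _) _                (inj₂ (inj₁ refl)) = u≢y refl
  nonBacktracking⇒start∉ e (step e' (step e'' w)) _         (x∉ , (y∉ , pw)) (inj₂ (inj₂ u∈w))
    with prefixTo G w u∈w
  ... | _ , q , q⊆w , path =
    acyclic (path+edge⇒cycle G (step e' (step e'' q)) ([ x∉ ∘ inj₁ , x∉ ∘ inj₂ ∘ q⊆w ] , y∉ ∘ q⊆w , path pw) e)

  nonBacktracking⇒isPath : ∀ {u v m} (w : Walk G u v m) → NonBacktracking G w → IsPath G w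
  nonBacktracking⇒isPath here       _  = tt
  nonBacktracking⇒isPath (step e w) nb = nonBacktracking⇒start∉ e w nb pw , pw
    where
    pw : IsPath G w
    pw = nonBacktracking⇒isPath w (NonBacktracking-tail G e w nb)

  closed-nonBacktracking⇒length≡0 : ∀ {a m} (w : Walk G a a m) → NonBacktracking G w → m ≡ 0
  closed-nonBacktracking⇒length≡0 here       _  = refl
  closed-nonBacktracking⇒length≡0 (step e w) nb = ⊥-elim (proj₁ (nonBacktracking⇒isPath (step e w) nb) (end∈ᵂ G w))

  -- Two non-backtracking walks a → b that leave a differently glue, after
  -- reversing the first, into a nontrivial closed non-backtracking walk.
  nonBacktracking-length-unique : ∀ {a b p q} (w : Walk G a b p) (w' : Walk G a b q) →
                                  NonBacktracking G w → NonBacktracking G w' → p ≡ q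
  nonBacktracking-length-unique here here _ _ = refl
  nonBacktracking-length-unique here (step e w') _ nb' with closed-nonBacktracking⇒length≡0 (step e w') nb'
  ... | ()
  nonBacktracking-length-unique (step e w) here nb _ with closed-nonBacktracking⇒length≡0 (step e w) nb
  ... | ()
  nonBacktracking-length-unique (step {w = x} {m = p} e w) (step {w = y} {m = q} e' w') nb nb' with x ≟ y
  ... | yes refl = cong suc (nonBacktracking-length-unique w w' (NonBacktracking-tail G e w nb) (NonBacktracking-tail G e' w' nb'))
  ... | no x≢y
    with trans (≡-sym (⊕≡+ (suc p) (suc q)))
               (closed-nonBacktracking⇒length≡0 (reverseAppend G (step e w) (step e' w'))
                 (reverseAppend-nonBacktracking G (step e w) (step e' w') nb nb' x≢y))
  ... | ()

  record SeparatingLeaf (v r : Fin n) : Set where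
    field
      leaf     : Fin n
      isLeaf   : IsLeaf G leaf
      {far}    : ℕ
      toV      : Walk G leaf v far
      toV-nb   : NonBacktracking G toV
      {near}   : ℕ
      toR      : Walk G leaf r near
      near<far : near < far

  separatingLeaf⇒distances≢ : ∀ {v r} (s : SeparatingLeaf v r) → let open SeparatingLeaf s in
                              ¬ (∃ λ m → Dist G leaf v m × Dist G leaf r m)
  separatingLeaf⇒distances≢ s (m , (geodesic , _) , (_ , minimal)) with shortcut G geodesic
  ... | m' , m'≤m , w , nb = <⇒≱ near<far (begin
      far   ≡⟨ nonBacktracking-length-unique toV w toV-nb nb ⟩
      m'    ≤⟨ m'≤m ⟩
      m     ≤⟨ minimal near toR ⟩
      near  ∎)
    where open SeparatingLeaf s

  -- Each step prepends an edge to P, which stays a path and so has fewer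
  -- than n edges: n steps of fuel suffice.
  extendToLeaf : ∀ {x v r L k} (fuel : ℕ) → n ≤ fuel + suc L →
                 (P : Walk G x v (suc L)) → NonBacktracking G P → Walk G x r k → k ≤ L →
                 SeparatingLeaf v r
  extendToLeaf zero n≤L P nb _ _ = ⊥-elim (<⇒≱ (IsPath⇒length<n G P (nonBacktracking⇒isPath P nb)) n≤L)
  extendToLeaf {x} {L = L} (suc fuel) bound (step {w = p} e w) nb E k≤L with degree G x in deg
  ... | zero         = ⊥-elim (Adj⇒degree≢0 G e deg)
  ... | suc zero     = record { leaf = x ; isLeaf = deg ; toV = step e w ; toV-nb = nb ; toR = E ; near<far = s≤s k≤L }
  ... | suc (suc _)
    with degree≥2⇒other-neighbour G (subst (2 ≤_) (≡-sym deg) (s≤s (s≤s z≤n))) p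
  ... | y , x~y , y≢p =
    extendToLeaf fuel (subst (n ≤_) (≡-sym (+-suc fuel (suc L))) bound) (step (Adj-sym G x~y) (step e w)) (y≢p , nb)
      (step (Adj-sym G x~y) E) (s≤s k≤L)

  separatingLeaf : Connected G → ∀ {v r} → v ≢ r → SeparatingLeaf v r
  separatingLeaf connected {v} {r} v≢r with shortcut G (proj₂ (connected r v))
  ... | _ , _ , here     , _  = ⊥-elim (v≢r refl)
  ... | _ , _ , step e w , nb = extendToLeaf n (m≤m+n n _) (step e w) nb here z≤n

leaves-resolve : ∀ {n k} {G : Graph n} → IsTree G → (u : Vec (Fin n) k) →
                 (∀ {ℓ} → IsLeaf G ℓ → ℓ ∈ u) → ∀ {v r} → SameResp G u v r → v ≡ r
leaves-resolve {G = G} (connected , acyclic) u leaves∈u {v} {r} same with v ≟ r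
... | yes v≡r = v≡r
... | no v≢r  = ⊥-elim (separatingLeaf⇒distances≢ acyclic s sameAtLeaf)
  where
  s : SeparatingLeaf acyclic v r
  s = separatingLeaf acyclic connected v≢r
  open SeparatingLeaf s using (leaf; isLeaf)
  sameAtLeaf : ∃ λ m → Dist G leaf v m × Dist G leaf r m
  sameAtLeaf = subst (λ c → ∃ λ m → Dist G c v m × Dist G c r m)
                     (≡-sym (lookup-index (leaves∈u isLeaf))) (same (index (leaves∈u isLeaf)))

-- numLeaves filters the vertices by a predicate local to Defs; it is
-- recovered here by unifying numLeaves G with the length of a filter.
filterPredicate : ∀ {n m} {keep : Fin n → Bool} → m ≡ length (filterᵇ keep (allFinL n)) → Fin n → Bool
filterPredicate {keep = keep} _ = keep

module _ {n : ℕ} (G : Graph n) where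

  isLeafᵇ : Fin n → Bool
  isLeafᵇ = filterPredicate {m = numLeaves G} refl

  leafProbe : Vec (Fin n) (numLeaves G)
  leafProbe = fromList (filterᵇ isLeafᵇ (allFinL n))

  leaf∈leafProbe : ∀ {ℓ} → IsLeaf G ℓ → ℓ ∈ leafProbe
  leaf∈leafProbe {ℓ} deg≡1 = ∈-fromList⁺ (∈-filter⁺ (T? ∘ isLeafᵇ) (∈-allFin ℓ) (isLeafᵇ-true deg≡1))
    where
    isLeafᵇ-true : degree G ℓ ≡ 1 → True (isLeafᵇ ℓ)
    isLeafᵇ-true deg≡1 with degree G ℓ | deg≡1
    ... | .1 | refl = tt

mainTheorem6 : ∀ (n : ℕ) (T : Graph n) (j : ℕ) → 2 ≤ j → IsTree T → numLeaves T ≡ j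
                   → CaptTime T j 1
mainTheorem6 n T .(numLeaves T) _ tree refl = captureInOneRound , noCaptureInZeroRounds
  where
  captureInOneRound : Win T (numLeaves T) 1 (AllVertices T)
  captureInOneRound = leafProbe T , λ r _ → inj₁ λ v _ → leaves-resolve tree (leafProbe T) (leaf∈leafProbe T)

  noCaptureInZeroRounds : ∀ t → t < 1 → ¬ Win T (numLeaves T) t (AllVertices T)
  noCaptureInZeroRounds zero _ ()
  noCaptureInZeroRounds (suc _) (s≤s ())
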